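{- Let $S$ be a commutative ring containing $\mathbb{Q}$. There is no family of polynomials $f_n\in S[x]$, $n\ge 1$, such that $f_{mn}=f_m\circ f_n$ for all $m,n\ge 1$ (i.e. $n\mapsto f_n$ is a representation of the multiplicative semigroup $(\mathbb{Z}_{\ge1},\cdot)$ by endomorphisms of $\mathbb{A}^1_S$) and such that $\frac{df_n}{dx}(x)=x^n-1$ for all $n\ge 1$. In other words, the generalized Mersenne sequence $\{x^n-1\}_{n\ge1}$ cannot occur as the matrix (Jacobian) divisibility sequence associated to a set of endomorphisms of $\mathbb{A}^1$.
   Context: For a representation $n\mapsto[n]$ of a semigroup by endomorphisms of affine $d$-space, the associated matrix divisibility sequence is the sequence of Jacobian matrices of the $[n]$; for $d=1$ this is the sequence of derivatives $\frac{d[n]}{dx}$. -}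

module Defs where

open import Level using (_⊔_)
open import Data.Nat using (ℕ; zero; suc)
open import Data.List using (List; []; _∷_)
open import Algebra.Bundles using (CommutativeRing)
open import Algebra.Morphism.Structures using (module RingMorphisms)
import Data.Rational.Properties as ℚP

module _ {c ℓ} (S : CommutativeRing c ℓ) where
  open CommutativeRing S
  open RingMorphisms (CommutativeRing.rawRing ℚP.+-*-commutativeRing) rawRing

  ContainsℚVia : (CommutativeRing.Carrier ℚP.+-*-commutativeRing → Carrier) → Set ℓ
  ContainsℚVia ι = IsRingMonomorphism ι

-- Univariate polynomials over S, as lists of coefficients (constant term first).
-- Equality of polynomials is coefficientwise (trailing zeros allowed).
module Poly {c ℓ} (S : CommutativeRing c ℓ) where
  open CommutativeRing S

  Pol : Set c
  Pol = List Carrier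

  coeff : Pol → ℕ → Carrier
  coeff []       _       = 0#
  coeff (a ∷ p)  zero    = a
  coeff (a ∷ p)  (suc k) = coeff p k

  infix 4 _≋_
  _≋_ : Pol → Pol → Set ℓ
  p ≋ q = ∀ k → coeff p k ≈ coeff q k

  const : Carrier → Pol
  const a = a ∷ []

  X : Pol
  X = 0# ∷ 1# ∷ []

  infixl 6 _⊕_
  _⊕_ : Pol → Pol → Pol
  []      ⊕ q       = q
  (a ∷ p) ⊕ []      = a ∷ p
  (a ∷ p) ⊕ (b ∷ q) = (a + b) ∷ (p ⊕ q)

  ⊖_ : Pol → Pol
  ⊖ []      = []
  ⊖ (a ∷ p) = (- a) ∷ (⊖ p)

  scale : Carrier → Pol → Pol
  scale a []      = []
  scale a (b ∷ p) = (a * b) ∷ scale a p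

  infixl 7 _⊗_
  _⊗_ : Pol → Pol → Pol
  []      ⊗ q = []
  (a ∷ p) ⊗ q = scale a q ⊕ (0# ∷ (p ⊗ q))

  _^ₚ_ : Pol → ℕ → Pol
  p ^ₚ zero  = const 1#
  p ^ₚ suc n = p ⊗ (p ^ₚ n)

  _∘ₚ_ : Pol → Pol → Pol
  []      ∘ₚ q = []
  (a ∷ p) ∘ₚ q = const a ⊕ (q ⊗ (p ∘ₚ q))

  _·ₙ_ : ℕ → Carrier → Carrier
  zero  ·ₙ a = 0#
  suc n ·ₙ a = a + (n ·ₙ a)

  private
    deriv′ : ℕ → Pol → Pol
    deriv′ k []      = []
    deriv′ k (a ∷ p) = (k ·ₙ a) ∷ deriv′ (suc k) p

  deriv : Pol → Pol
  deriv []      = []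
  deriv (a ∷ p) = deriv′ 1 p

  mersenne : ℕ → Pol
  mersenne n = (X ^ₚ n) ⊕ (⊖ const 1#)

-- If the family existed, f₁ = f₁ ∘ f₁ would be an idempotent polynomial with f₁′ = x − 1, so its
-- x²-coefficient c₂ satisfies 2c₂ = 1. Over any commutative ring such a polynomial forces 1 = 0.
-- Induct on a degree bound L: for L ≤ 1, c₂ = 0. For L ≥ 2, comparing the coefficients of x^(L²)
-- in f₁ ∘ f₁ = f₁ shows that the top coefficient a satisfies a^(L+1) = 0, while modulo a the bound
-- drops to L − 1, so by induction 1 ∈ (a): a is a nilpotent unit, whence 1 = 0. As S ⊇ ℚ, 1 ≠ 0.
module Submission where

open import Defs
open import Level using (Level; _⊔_)
open import Data.Nat using (ℕ; zero; suc; _*_; _<_; z≤n; s≤s)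
import Data.Nat as ℕ
open import Data.Nat.Properties using (m≤n+m; <⇒≤; ≤-trans; m≤n⇒m<n∨m≡n; m<m+n)
open import Data.List using ([]; _∷_; length)
open import Data.Product using (_×_; Σ; _,_; proj₁)
open import Data.Sum using (inj₁; inj₂)
open import Relation.Nullary using (¬_)
open import Relation.Binary.PropositionalEquality as ≡ using (_≡_)
open import Algebra.Bundles using (CommutativeRing)
open import Algebra.Morphism.Structures using (module RingMorphisms)
import Algebra.Solver.Ring.NaturalCoefficients.Default as NaturalSolver
open import Data.Rational using (0ℚ; 1ℚ)
import Data.Rational.Properties as ℚP

module _ {c ℓ} (R : CommutativeRing c ℓ) where
  open CommutativeRing R hiding (zero) renaming (_*_ to _·_)
  open Poly R
  open import Algebra.Properties.CommutativeSemiring.Exp commutativeSemiring using (_^_)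
  open NaturalSolver commutativeSemiring using (solve; _:=_; _:*_)

  DegreeAtMost : Pol → ℕ → Set ℓ
  DegreeAtMost p d = ∀ m → d < m → coeff p m ≈ 0#

  IsIdempotent : Pol → Set ℓ
  IsIdempotent f = f ≋ f ∘ₚ f

  HasQuadraticCoeffHalf : Pol → Set ℓ
  HasQuadraticCoeffHalf f = coeff f 2 + coeff f 2 ≈ 1#

  coeff-beyond-length : ∀ p {m} → length p ℕ.≤ m → coeff p m ≡ 0#
  coeff-beyond-length []      _           = ≡.refl
  coeff-beyond-length (_ ∷ p) (s≤s len≤m) = coeff-beyond-length p len≤m

  degree≤length : ∀ p → DegreeAtMost p (length p)
  degree≤length p m len<m = reflexive (coeff-beyond-length p (<⇒≤ len<m))

  coeff-⊕ : ∀ p q k → coeff (p ⊕ q) k ≈ coeff p k + coeff q k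
  coeff-⊕ []      q       k       = sym (+-identityˡ _)
  coeff-⊕ (a ∷ p) []      k       = sym (+-identityʳ _)
  coeff-⊕ (a ∷ p) (b ∷ q) zero    = refl
  coeff-⊕ (a ∷ p) (b ∷ q) (suc k) = coeff-⊕ p q k

  coeff-scale : ∀ a p k → coeff (scale a p) k ≈ a · coeff p k
  coeff-scale a []      k       = sym (zeroʳ a)
  coeff-scale a (b ∷ p) zero    = refl
  coeff-scale a (b ∷ p) (suc k) = coeff-scale a p k

  coeff-∷⊗ : ∀ a p q k → coeff ((a ∷ p) ⊗ q) k ≈ a · coeff q k + coeff (0# ∷ p ⊗ q) k
  coeff-∷⊗ a p q k = trans (coeff-⊕ (scale a q) _ k) (+-congʳ (coeff-scale a q k))

  coeff-∷∘ₚ : ∀ a p q k → coeff ((a ∷ p) ∘ₚ q) k ≈ coeff (const a) k + coeff (q ⊗ (p ∘ₚ q)) k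
  coeff-∷∘ₚ a p q = coeff-⊕ (const a) (q ⊗ (p ∘ₚ q))

  ∷-vanishes : ∀ {a p} → a ≈ 0# → p ≋ [] → a ∷ p ≋ []
  ∷-vanishes a≈0 p≋[] zero    = a≈0
  ∷-vanishes a≈0 p≋[] (suc k) = p≋[] k

  ⊗-vanishesˡ : ∀ p q → p ≋ [] → p ⊗ q ≋ []
  ⊗-vanishesˡ []      q p≋[] k = refl
  ⊗-vanishesˡ (a ∷ p) q p≋[] k = begin
    coeff ((a ∷ p) ⊗ q) k               ≈⟨ coeff-∷⊗ a p q k ⟩
    a · coeff q k + coeff (0# ∷ p ⊗ q) k ≈⟨ +-cong (*-congʳ (p≋[] 0)) (0∷p⊗q≋[] k) ⟩
    0# · coeff q k + 0#                 ≈⟨ +-identityʳ _ ⟩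
    0# · coeff q k                      ≈⟨ zeroˡ _ ⟩
    0#                                  ∎
    where
    open import Relation.Binary.Reasoning.Setoid setoid
    0∷p⊗q≋[] : 0# ∷ p ⊗ q ≋ []
    0∷p⊗q≋[] = ∷-vanishes refl (⊗-vanishesˡ p q (λ j → p≋[] (suc j)))

  ⊗-vanishesʳ : ∀ p q → q ≋ [] → p ⊗ q ≋ []
  ⊗-vanishesʳ []      q q≋[] k = refl
  ⊗-vanishesʳ (a ∷ p) q q≋[] k =
    trans (coeff-∷⊗ a p q k)
      (trans (+-cong (trans (*-congˡ (q≋[] k)) (zeroʳ a))
                     (∷-vanishes refl (⊗-vanishesʳ p q q≋[]) k))
        (+-identityʳ 0#))

  ∘ₚ-vanishesˡ : ∀ p q → p ≋ [] → p ∘ₚ q ≋ []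
  ∘ₚ-vanishesˡ []      q p≋[] k = refl
  ∘ₚ-vanishesˡ (a ∷ p) q p≋[] k =
    trans (coeff-∷∘ₚ a p q k)
      (trans (+-cong (∷-vanishes (p≋[] 0) (λ _ → refl) k)
                     (⊗-vanishesʳ q _ (∘ₚ-vanishesˡ p q (λ j → p≋[] (suc j))) k))
        (+-identityʳ 0#))

  coeff-constant⊗ : ∀ a p q → p ≋ [] → ∀ k → coeff ((a ∷ p) ⊗ q) k ≈ a · coeff q k
  coeff-constant⊗ a p q p≋[] k =
    trans (coeff-∷⊗ a p q k)
      (trans (+-congˡ (∷-vanishes refl (⊗-vanishesˡ p q p≋[]) k)) (+-identityʳ _))

  degree-∷ : ∀ {a p d} → DegreeAtMost (a ∷ p) (suc d) → DegreeAtMost p d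
  degree-∷ deg m d<m = deg (suc m) (s≤s d<m)

  degree-0-∷ : ∀ {a p} → DegreeAtMost (a ∷ p) 0 → p ≋ []
  degree-0-∷ deg k = deg (suc k) (s≤s z≤n)

  ⊗-degree : ∀ p q dp dq → DegreeAtMost p dp → DegreeAtMost q dq →
             DegreeAtMost (p ⊗ q) (dp ℕ.+ dq)
  ⊗-degree []      q dp       dq degp degq m _ = refl
  ⊗-degree (a ∷ p) q zero     dq degp degq m dq<m =
    trans (coeff-constant⊗ a p q (degree-0-∷ degp) m) (trans (*-congˡ (degq m dq<m)) (zeroʳ a))
  ⊗-degree (a ∷ p) q (suc dp) dq degp degq (suc m) (s≤s dp+dq<m) =
    trans (coeff-∷⊗ a p q (suc m))
      (trans (+-cong (trans (*-congˡ (degq (suc m) dq<1+m)) (zeroʳ a))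
                     (⊗-degree p q dp dq (degree-∷ degp) degq m dp+dq<m))
        (+-identityʳ 0#))
    where
    dq<1+m : dq < suc m
    dq<1+m = s≤s (≤-trans (m≤n+m dq dp) (<⇒≤ dp+dq<m))

  ⊗-coeff-top : ∀ p q dp dq → DegreeAtMost p dp → DegreeAtMost q dq →
                coeff (p ⊗ q) (dp ℕ.+ dq) ≈ coeff p dp · coeff q dq
  ⊗-coeff-top []      q dp       dq degp degq = sym (zeroˡ _)
  ⊗-coeff-top (a ∷ p) q zero     dq degp degq = coeff-constant⊗ a p q (degree-0-∷ degp) dq
  ⊗-coeff-top (a ∷ p) q (suc dp) dq degp degq =
    trans (coeff-∷⊗ a p q (suc (dp ℕ.+ dq)))
      (trans (+-cong (trans (*-congˡ (degq _ (s≤s (m≤n+m dq dp)))) (zeroʳ a))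
                     (⊗-coeff-top p q dp dq (degree-∷ degp) degq))
        (+-identityˡ _))

  ∘ₚ-degree : ∀ p q L d → DegreeAtMost p L → DegreeAtMost q (suc d) →
              DegreeAtMost (p ∘ₚ q) (L * suc d)
  ∘ₚ-degree []      q L       d degp degq m _ = refl
  ∘ₚ-degree (a ∷ p) q zero    d degp degq (suc m) _ =
    trans (coeff-∷∘ₚ a p q (suc m))
      (trans (+-identityˡ _) (⊗-vanishesʳ q _ (∘ₚ-vanishesˡ p q (degree-0-∷ degp)) (suc m)))
  ∘ₚ-degree (a ∷ p) q (suc L) d degp degq (suc m) L′<m =
    trans (coeff-∷∘ₚ a p q (suc m))
      (trans (+-identityˡ _)
        (⊗-degree q _ (suc d) (L * suc d) degq (∘ₚ-degree p q L d (degree-∷ degp) degq) (suc m) L′<m))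

  ∘ₚ-coeff-top : ∀ p q L d → DegreeAtMost p L → DegreeAtMost q (suc d) →
                 coeff (p ∘ₚ q) (L * suc d) ≈ coeff p L · coeff q (suc d) ^ L
  ∘ₚ-coeff-top []      q L       d degp degq = sym (zeroˡ _)
  ∘ₚ-coeff-top (a ∷ p) q zero    d degp degq =
    trans (coeff-∷∘ₚ a p q 0)
      (trans (+-congˡ (⊗-vanishesʳ q _ (∘ₚ-vanishesˡ p q (degree-0-∷ degp)) 0))
        (trans (+-identityʳ a) (sym (*-identityʳ a))))
  ∘ₚ-coeff-top (a ∷ p) q (suc L) d degp degq =
    trans (coeff-∷∘ₚ a p q (suc (d ℕ.+ L * suc d)))
      (trans (+-identityˡ _)
        (trans (⊗-coeff-top q _ (suc d) (L * suc d) degq (∘ₚ-degree p q L d degp′ degq))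
          (trans (*-congˡ (∘ₚ-coeff-top p q L d degp′ degq)) (swap _ _ _))))
    where
    degp′ : DegreeAtMost p L
    degp′ = degree-∷ degp
    swap : ∀ x y z → x · (y · z) ≈ y · (x · z)
    swap = solve 3 (λ x y z → x :* (y :* z) := y :* (x :* z)) refl

  quadraticCoeff-vanishing⇒trivial : ∀ f → coeff f 2 ≈ 0# → HasQuadraticCoeffHalf f → 1# ≈ 0#
  quadraticCoeff-vanishing⇒trivial f c₂≈0 half =
    trans (sym half) (trans (+-cong c₂≈0 c₂≈0) (+-identityʳ 0#))

  idempotent⇒leading-nilpotent : ∀ f k → DegreeAtMost f (suc (suc k)) → IsIdempotent f →
                                 coeff f (suc (suc k)) ^ suc (suc (suc k)) ≈ 0#
  idempotent⇒leading-nilpotent f k deg idem = begin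
    a · a ^ L              ≈⟨ ∘ₚ-coeff-top f f L (suc k) deg deg ⟨
    coeff (f ∘ₚ f) (L * L) ≈⟨ idem (L * L) ⟨
    coeff f (L * L)        ≈⟨ deg (L * L) (m<m+n L (s≤s z≤n)) ⟩
    0#                     ∎
    where
    open import Relation.Binary.Reasoning.Setoid setoid
    L : ℕ
    L = suc (suc k)
    a : Carrier
    a = coeff f L

  nilpotent-unit⇒trivial : ∀ {a u} n → a · u ≈ 1# → a ^ n ≈ 0# → 1# ≈ 0#
  nilpotent-unit⇒trivial zero    _     a⁰≈0 = a⁰≈0
  nilpotent-unit⇒trivial {a} {u} n@(suc _) au≈1 aⁿ≈0 = begin
    1#            ≈⟨ ×-idem (*-identityˡ 1#) n ⟨
    1# ^ n        ≈⟨ ^-congˡ n au≈1 ⟨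
    (a · u) ^ n   ≈⟨ ^-distrib-* a u n ⟩
    a ^ n · u ^ n ≈⟨ *-congʳ aⁿ≈0 ⟩
    0# · u ^ n    ≈⟨ zeroˡ _ ⟩
    0#            ∎
    where
    open import Relation.Binary.Reasoning.Setoid setoid
    open import Algebra.Properties.CommutativeSemiring.Exp commutativeSemiring using (^-congˡ; ^-distrib-*)
    open import Algebra.Properties.Monoid.Mult *-monoid using (×-idem)

  deriv-coeff-1 : ∀ p → coeff (deriv p) 1 ≈ coeff p 2 + coeff p 2
  deriv-coeff-1 []                = sym (+-identityˡ 0#)
  deriv-coeff-1 (_ ∷ [])          = sym (+-identityˡ 0#)
  deriv-coeff-1 (_ ∷ _ ∷ [])      = sym (+-identityˡ 0#)
  deriv-coeff-1 (_ ∷ _ ∷ c₂ ∷ _)  = +-congˡ (+-identityʳ c₂)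

  mersenne-1-coeff-1 : coeff (mersenne 1) 1 ≈ 1#
  mersenne-1-coeff-1 = trans (+-identityʳ _) (*-identityˡ 1#)

  deriv≋x-1⇒quadraticCoeffHalf : ∀ f → deriv f ≋ mersenne 1 → HasQuadraticCoeffHalf f
  deriv≋x-1⇒quadraticCoeffHalf f f′≋x-1 =
    trans (sym (deriv-coeff-1 f)) (trans (f′≋x-1 1) mersenne-1-coeff-1)

module PrincipalQuotient {c ℓ} (R : CommutativeRing c ℓ) (a : CommutativeRing.Carrier R) where
  open CommutativeRing R hiding (zero) renaming (_*_ to _·_)
  open import Algebra.Properties.Ring ring using (-‿+-comm; -‿distribʳ-*)
  open import Relation.Binary.Reasoning.Setoid setoid
  open NaturalSolver commutativeSemiring using (solve; _:=_; _:+_; _:*_)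

  infix 4 _≈ₐ_
  _≈ₐ_ : Carrier → Carrier → Set (c ⊔ ℓ)
  x ≈ₐ y = Σ Carrier λ r → x ≈ y + a · r

  unit : (1≈0 : 1# ≈ₐ 0#) → a · proj₁ 1≈0 ≈ 1#
  unit (r , 1≈0+ar) = sym (trans 1≈0+ar (+-identityˡ _))

  ≈⇒≈ₐ : ∀ {x y} → x ≈ y → x ≈ₐ y
  ≈⇒≈ₐ {y = y} x≈y = 0# , trans x≈y (sym (trans (+-congˡ (zeroʳ a)) (+-identityʳ y)))

  ≈ₐ-sym : ∀ {x y} → x ≈ₐ y → y ≈ₐ x
  ≈ₐ-sym {x} {y} (r , x≈y+ar) = - r , (begin
    y                       ≈⟨ +-identityʳ y ⟨
    y + 0#                  ≈⟨ +-congˡ (-‿inverseʳ (a · r)) ⟨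
    y + (a · r + - (a · r)) ≈⟨ +-assoc y _ _ ⟨
    y + a · r + - (a · r)   ≈⟨ +-congʳ x≈y+ar ⟨
    x + - (a · r)           ≈⟨ +-congˡ (-‿distribʳ-* a r) ⟩
    x + a · - r             ∎)

  ≈ₐ-trans : ∀ {x y z} → x ≈ₐ y → y ≈ₐ z → x ≈ₐ z
  ≈ₐ-trans {x} {y} {z} (r , x≈y+ar) (s , y≈z+as) = s + r , (begin
    x                 ≈⟨ x≈y+ar ⟩
    y + a · r         ≈⟨ +-congʳ y≈z+as ⟩
    z + a · s + a · r ≈⟨ regroup z a s r ⟩
    z + a · (s + r)   ∎)
    where
    regroup : ∀ z a s r → z + a · s + a · r ≈ z + a · (s + r)
    regroup = solve 4 (λ z a s r → z :+ a :* s :+ a :* r := z :+ a :* (s :+ r)) refl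

  ≈ₐ-+-cong : ∀ {x y u v} → x ≈ₐ y → u ≈ₐ v → x + u ≈ₐ y + v
  ≈ₐ-+-cong {y = y} {v = v} (r , x≈y+ar) (s , u≈v+as) = r + s , (begin
    _ + _                   ≈⟨ +-cong x≈y+ar u≈v+as ⟩
    (y + a · r) + (v + a · s) ≈⟨ regroup y v a r s ⟩
    (y + v) + a · (r + s)     ∎)
    where
    regroup : ∀ y v a r s → (y + a · r) + (v + a · s) ≈ (y + v) + a · (r + s)
    regroup = solve 5 (λ y v a r s → (y :+ a :* r) :+ (v :+ a :* s) := (y :+ v) :+ a :* (r :+ s)) refl

  ≈ₐ-*-cong : ∀ {x y u v} → x ≈ₐ y → u ≈ₐ v → x · u ≈ₐ y · v
  ≈ₐ-*-cong {y = y} {v = v} (r , x≈y+ar) (s , u≈v+as) = r · v + y · s + a · (r · s) , (begin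
    _ · _                                   ≈⟨ *-cong x≈y+ar u≈v+as ⟩
    (y + a · r) · (v + a · s)               ≈⟨ expand y v a r s ⟩
    y · v + a · (r · v + y · s + a · (r · s)) ∎)
    where
    expand : ∀ y v a r s → (y + a · r) · (v + a · s) ≈ y · v + a · (r · v + y · s + a · (r · s))
    expand = solve 5 (λ y v a r s → (y :+ a :* r) :* (v :+ a :* s)
                                   := y :* v :+ a :* (r :* v :+ y :* s :+ a :* (r :* s))) refl

  ≈ₐ-‿cong : ∀ {x y} → x ≈ₐ y → - x ≈ₐ - y
  ≈ₐ-‿cong {y = y} (r , x≈y+ar) = - r , (begin
    - _             ≈⟨ -‿cong x≈y+ar ⟩
    - (y + a · r)   ≈⟨ -‿+-comm y (a · r) ⟨
    - y + - (a · r) ≈⟨ +-congˡ (-‿distribʳ-* a r) ⟩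
    - y + a · - r   ∎)

  quotient : CommutativeRing c (c ⊔ ℓ)
  quotient = record
    { Carrier = Carrier
    ; _≈_ = _≈ₐ_
    ; _+_ = _+_
    ; _*_ = _·_
    ; -_ = -_
    ; 0# = 0#
    ; 1# = 1#
    ; isCommutativeRing = record
      { isRing = record
        { +-isAbelianGroup = record
          { isGroup = record
            { isMonoid = record
              { isSemigroup = record
                { isMagma = record
                  { isEquivalence = record { refl = ≈⇒≈ₐ refl ; sym = ≈ₐ-sym ; trans = ≈ₐ-trans }
                  ; ∙-cong = ≈ₐ-+-cong
                  }
                ; assoc = λ x y z → ≈⇒≈ₐ (+-assoc x y z)
                }
              ; identity = (λ x → ≈⇒≈ₐ (+-identityˡ x)) , (λ x → ≈⇒≈ₐ (+-identityʳ x))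
              }
            ; inverse = (λ x → ≈⇒≈ₐ (-‿inverseˡ x)) , (λ x → ≈⇒≈ₐ (-‿inverseʳ x))
            ; ⁻¹-cong = ≈ₐ-‿cong
            }
          ; comm = λ x y → ≈⇒≈ₐ (+-comm x y)
          }
        ; *-cong = ≈ₐ-*-cong
        ; *-assoc = λ x y z → ≈⇒≈ₐ (*-assoc x y z)
        ; *-identity = (λ x → ≈⇒≈ₐ (*-identityˡ x)) , (λ x → ≈⇒≈ₐ (*-identityʳ x))
        ; distrib = (λ x y z → ≈⇒≈ₐ (distribˡ x y z)) , (λ x y z → ≈⇒≈ₐ (distribʳ x y z))
        }
      ; *-comm = λ x y → ≈⇒≈ₐ (*-comm x y)
      }
    }

  private
    module P = Poly R
    module Pₐ = Poly quotient

  ⊕-quotient : ∀ p q → p Pₐ.⊕ q ≡ p P.⊕ q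
  ⊕-quotient []      q       = ≡.refl
  ⊕-quotient (x ∷ p) []      = ≡.refl
  ⊕-quotient (x ∷ p) (y ∷ q) = ≡.cong (x + y ∷_) (⊕-quotient p q)

  scale-quotient : ∀ x p → Pₐ.scale x p ≡ P.scale x p
  scale-quotient x []      = ≡.refl
  scale-quotient x (y ∷ p) = ≡.cong (x · y ∷_) (scale-quotient x p)

  ⊗-quotient : ∀ p q → p Pₐ.⊗ q ≡ p P.⊗ q
  ⊗-quotient []      q = ≡.refl
  ⊗-quotient (x ∷ p) q = ≡.trans (⊕-quotient (Pₐ.scale x q) (0# ∷ p Pₐ.⊗ q))
    (≡.cong₂ P._⊕_ (scale-quotient x q) (≡.cong (0# ∷_) (⊗-quotient p q)))

  ∘ₚ-quotient : ∀ p q → p Pₐ.∘ₚ q ≡ p P.∘ₚ q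
  ∘ₚ-quotient []      q = ≡.refl
  ∘ₚ-quotient (x ∷ p) q = ≡.trans (⊕-quotient (P.const x) (q Pₐ.⊗ (p Pₐ.∘ₚ q)))
    (≡.cong (P.const x P.⊕_) (≡.trans (⊗-quotient q (p Pₐ.∘ₚ q)) (≡.cong (q P.⊗_) (∘ₚ-quotient p q))))

  coeff-quotient : ∀ p k → Pₐ.coeff p k ≡ P.coeff p k
  coeff-quotient []      k       = ≡.refl
  coeff-quotient (x ∷ p) zero    = ≡.refl
  coeff-quotient (x ∷ p) (suc k) = coeff-quotient p k

  ≈⇒coeff-quotient : ∀ p k {y} → P.coeff p k ≈ y → Pₐ.coeff p k ≈ₐ y
  ≈⇒coeff-quotient p k eq rewrite coeff-quotient p k = ≈⇒≈ₐ eq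

  idempotent-quotient : ∀ f → IsIdempotent R f → IsIdempotent quotient f
  idempotent-quotient f idem k rewrite coeff-quotient (f Pₐ.∘ₚ f) k | ∘ₚ-quotient f f =
    ≈⇒coeff-quotient f k (idem k)

  quadraticCoeffHalf-quotient : ∀ f → HasQuadraticCoeffHalf R f → HasQuadraticCoeffHalf quotient f
  quadraticCoeffHalf-quotient f half rewrite coeff-quotient f 2 = ≈⇒≈ₐ half

  degree-quotient : ∀ f d → DegreeAtMost R f (suc d) → P.coeff f (suc d) ≡ a →
                    DegreeAtMost quotient f d
  degree-quotient f d deg top≡a m d<m rewrite coeff-quotient f m with m≤n⇒m<n∨m≡n d<m
  ... | inj₁ 1+d<m  = ≈⇒≈ₐ (deg m 1+d<m)
  ... | inj₂ ≡.refl rewrite top≡a = 1# , sym (trans (+-identityˡ _) (*-identityʳ a))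

idempotent⇒trivial : ∀ L {c ℓ} (R : CommutativeRing c ℓ) f → DegreeAtMost R f L →
                     IsIdempotent R f → HasQuadraticCoeffHalf R f →
                     CommutativeRing._≈_ R (CommutativeRing.1# R) (CommutativeRing.0# R)
idempotent⇒trivial 0 R f deg _ half = quadraticCoeff-vanishing⇒trivial R f (deg 2 (s≤s z≤n)) half
idempotent⇒trivial 1 R f deg _ half = quadraticCoeff-vanishing⇒trivial R f (deg 2 (s≤s (s≤s z≤n))) half
idempotent⇒trivial (suc (suc k)) R f deg idem half =
  nilpotent-unit⇒trivial R (suc (suc (suc k)))
    (unit (idempotent⇒trivial (suc k) quotient f deg-mod-a idem-mod-a half-mod-a))
    (idempotent⇒leading-nilpotent R f k deg idem)
  where
  open PrincipalQuotient R (Poly.coeff R f (suc (suc k)))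
  deg-mod-a : DegreeAtMost quotient f (suc k)
  deg-mod-a = degree-quotient f (suc k) deg ≡.refl
  idem-mod-a : IsIdempotent quotient f
  idem-mod-a = idempotent-quotient f idem
  half-mod-a : HasQuadraticCoeffHalf quotient f
  half-mod-a = quadraticCoeffHalf-quotient f half

containsℚ⇒nontrivial : ∀ {c ℓ} (S : CommutativeRing c ℓ) {ι} → ContainsℚVia S ι →
                        ¬ CommutativeRing._≈_ S (CommutativeRing.1# S) (CommutativeRing.0# S)
containsℚ⇒nontrivial S ι-monomorphism 1≈0 =
  1ℚ≢0ℚ (injective (trans 1#-homo (trans 1≈0 (sym 0#-homo))))
  where
  open CommutativeRing S
  open RingMorphisms (CommutativeRing.rawRing ℚP.+-*-commutativeRing) rawRing
  open IsRingMonomorphism ι-monomorphism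
  1ℚ≢0ℚ : ¬ (1ℚ ≡ 0ℚ)
  1ℚ≢0ℚ ()

mainTheorem2 : ∀ {c ℓ : Level} (S : CommutativeRing c ℓ) →
    Σ (CommutativeRing.Carrier ℚP.+-*-commutativeRing → CommutativeRing.Carrier S) (ContainsℚVia S) →
    ¬ (Σ (ℕ → Poly.Pol S) λ f →
        (∀ m n → Poly._≋_ S (f (suc m * suc n)) (Poly._∘ₚ_ S (f (suc m)) (f (suc n))))
        × (∀ n → Poly._≋_ S (Poly.deriv S (f (suc n))) (Poly.mersenne S (suc n))))
mainTheorem2 S (ι , ι-monomorphism) (f , f-comp , f-deriv) =
  containsℚ⇒nontrivial S ι-monomorphism
    (idempotent⇒trivial (length (f 1)) S (f 1) (degree≤length S (f 1)) (f-comp 0 0)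
      (deriv≋x-1⇒quadraticCoeffHalf S (f 1) (f-deriv 0)))
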